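{- Let $G$ be a non-trivial connected graph. (a) The following are equivalent: (i) $G$ is complete; (ii) $\mathrm{diam}(G)=1$; (iii) $rc(G)=1$; (iv) $src(G)=1$; (v) $rvc(G)=0$; (vi) $srvc(G)=0$; (vii) $trc(G)=1$; (viii) $strc(G)=1$. (b) $strc(G)\ge trc(G)\ge 3$ if and only if $G$ is not a complete graph. (c) (i) $rc(G)=2$ iff $src(G)=2$. (ii) $rvc(G)=1$ iff $srvc(G)=1$ iff $\mathrm{diam}(G)=2$. (iii) $rvc(G)=2$ iff $srvc(G)=2$. (iv) $trc(G)=3$ iff $strc(G)=3$. (v) $trc(G)=4$ iff $strc(G)=4$. Moreover, any of the conditions in (i) implies any of the conditions in (iv), and any of the conditions in (i), (iv) and (v) implies any of the conditions in (ii).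
   Context: All graphs are finite and simple; $u$–$v$ geodesic means a $u$–$v$ path of length $d(u,v)$. An edge-coloured path is rainbow if its edges have distinct colours; $rc(G)$ (resp. $src(G)$) is the minimum number of colours in an edge-colouring of $G$ in which any two vertices are joined by a rainbow path (resp. rainbow geodesic). A vertex-coloured path is vertex-rainbow if its internal vertices have distinct colours; $rvc(G)$ (resp. $srvc(G)$) is the minimum number of colours in a vertex-colouring in which any two vertices are joined by a vertex-rainbow path (resp. vertex-rainbow geodesic), with value $0$ for complete graphs. A total-coloured path is total-rainbow if its edges and internal vertices have pairwise distinct colours; $trc(G)$ (resp. $strc(G)$) is the minimum number of colours in a total-colouring (vertices and edges) in which any two vertices are joined by a total-rainbow path (resp. total-rainbow geodesic). -}

module Defs where

open import Data.Nat using (ℕ; zero; suc; _≤_; _<_)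
open import Data.Fin using (Fin)
open import Data.Bool using (Bool; true; false)
open import Data.List using (List; []; _∷_; _++_; length)
open import Data.List.Relation.Unary.Unique.Propositional using (Unique)
open import Data.Product using (Σ; ∃; ∃-syntax; _×_; _,_)
open import Data.Sum using (_⊎_)
open import Relation.Binary.PropositionalEquality using (_≡_; _≢_)
open import Relation.Nullary using (¬_)

record Graph (n : ℕ) : Set where
  field
    adj     : Fin n → Fin n → Bool
    symm    : ∀ u v → adj u v ≡ adj v u
    irrefl  : ∀ v → adj v v ≡ false

open Graph public

module _ {n : ℕ} (G : Graph n) where

  Adj : Fin n → Fin n → Set
  Adj u v = adj G u v ≡ true

  data Walk : Fin n → Fin n → Set where
    [_]  : (v : Fin n) → Walk v v
    step : ∀ {u w v} → Adj u w → Walk w v → Walk u v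

  len : ∀ {u v} → Walk u v → ℕ
  len [ v ]      = zero
  len (step _ p) = suc (len p)

  verts : ∀ {u v} → Walk u v → List (Fin n)
  verts [ v ]              = v ∷ []
  verts (step {u} _ p)     = u ∷ verts p

  initVerts : ∀ {u v} → Walk u v → List (Fin n)
  initVerts [ v ]          = []
  initVerts (step {u} _ p) = u ∷ initVerts p

  internal : ∀ {u v} → Walk u v → List (Fin n)
  internal [ v ]      = []
  internal (step _ p) = initVerts p

  Path : Fin n → Fin n → Set
  Path u v = Σ (Walk u v) (λ p → Unique (verts p))

  Connected : Set
  Connected = ∀ u v → Path u v

  Complete : Set
  Complete = ∀ u v → u ≢ v → Adj u v

IsMin : (ℕ → Set) → ℕ → Set
IsMin P k = P k × (∀ j → P j → k ≤ j)

module _ {n : ℕ} (G : Graph n) where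

  Dist : Fin n → Fin n → ℕ → Set
  Dist u v = IsMin (λ l → Σ (Path G u v) (λ p → len G (Data.Product.proj₁ p) ≡ l))

  Diam : ℕ → Set
  Diam D = (Σ (Fin n) λ u → Σ (Fin n) λ v → Dist u v D)
         × (∀ u v d → Dist u v d → d ≤ D)

  Geodesic : Fin n → Fin n → Set
  Geodesic u v = Σ (Path G u v) (λ p → Dist u v (len G (Data.Product.proj₁ p)))

  edgeCols : ∀ {k} → (Fin n → Fin n → Fin k) → ∀ {u v} → Walk G u v → List (Fin k)
  edgeCols c [ v ]              = []
  edgeCols c (step {u} {w} _ p) = c u w ∷ edgeCols c p

  vertCols : ∀ {k} → (Fin n → Fin k) → List (Fin n) → List (Fin k)
  vertCols f []       = []
  vertCols f (x ∷ xs) = f x ∷ vertCols f xs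

  -- edge-colourings with k colours (a colour for each unordered pair;
  -- only the values on edges matter)
  EdgeColouring : ℕ → Set
  EdgeColouring k = Σ (Fin n → Fin n → Fin k) (λ c → ∀ u v → c u v ≡ c v u)

  RainbowConnecting : ∀ {k} → EdgeColouring k → Set
  RainbowConnecting (c , _) =
    ∀ u v → Σ (Path G u v) (λ p → Unique (edgeCols c (Data.Product.proj₁ p)))

  StronglyRainbowConnecting : ∀ {k} → EdgeColouring k → Set
  StronglyRainbowConnecting (c , _) =
    ∀ u v → Σ (Geodesic u v)
              (λ g → Unique (edgeCols c (Data.Product.proj₁ (Data.Product.proj₁ g))))

  VertexRainbowConnecting : ∀ {k} → (Fin n → Fin k) → Set
  VertexRainbowConnecting f =
    ∀ u v → Σ (Path G u v) (λ p → Unique (vertCols f (internal G (Data.Product.proj₁ p))))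

  StronglyVertexRainbowConnecting : ∀ {k} → (Fin n → Fin k) → Set
  StronglyVertexRainbowConnecting f =
    ∀ u v → Σ (Geodesic u v)
              (λ g → Unique (vertCols f (internal G (Data.Product.proj₁ (Data.Product.proj₁ g)))))

  TotalColouring : ℕ → Set
  TotalColouring k = (Fin n → Fin k) × EdgeColouring k

  TotalRainbowConnecting : ∀ {k} → TotalColouring k → Set
  TotalRainbowConnecting (f , c , _) =
    ∀ u v → Σ (Path G u v) (λ p →
      Unique (edgeCols c (Data.Product.proj₁ p) ++ vertCols f (internal G (Data.Product.proj₁ p))))

  StronglyTotalRainbowConnecting : ∀ {k} → TotalColouring k → Set
  StronglyTotalRainbowConnecting (f , c , _) =
    ∀ u v → Σ (Geodesic u v) (λ g →
      Unique (edgeCols c (Data.Product.proj₁ (Data.Product.proj₁ g))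
              ++ vertCols f (internal G (Data.Product.proj₁ (Data.Product.proj₁ g)))))

  RC SRC TRC STRC : ℕ → Set
  RC   = IsMin (λ k → Σ (EdgeColouring k) RainbowConnecting)
  SRC  = IsMin (λ k → Σ (EdgeColouring k) StronglyRainbowConnecting)
  TRC  = IsMin (λ k → Σ (TotalColouring k) TotalRainbowConnecting)
  STRC = IsMin (λ k → Σ (TotalColouring k) StronglyTotalRainbowConnecting)

  -- rvc(G) ≡ k, srvc(G) ≡ k, with the convention value 0 for complete graphs
  RVC SRVC : ℕ → Set
  RVC k  = (Complete G × k ≡ 0)
         ⊎ (¬ Complete G × IsMin (λ j → Σ (Fin n → Fin j) VertexRainbowConnecting) k)
  SRVC k = (Complete G × k ≡ 0)
         ⊎ (¬ Complete G × IsMin (λ j → Σ (Fin n → Fin j) StronglyVertexRainbowConnecting) k)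

module Submission where

-- Every statement of the theorem is read off from a few
-- elementary facts about a connected graph G on n ≥ 2 vertices.
--   * Counting (module Walks): a duplicate-free list over k colours has at
--     most k entries, so a rainbow / vertex-rainbow / total-rainbow walk of
--     length ℓ with k colours satisfies ℓ ≤ k / ℓ - 1 ≤ k / ℓ + (ℓ - 1) ≤ k.
--     Hence few colours force all distances ≤ 1 (G complete) or ≤ 2.
--   * Short geodesics (shortenToGeodesic): a path of length ≤ 3 is either a
--     geodesic or joins vertices at distance ≤ 2, which are joined by an
--     explicit geodesic shorter than the path.  So any property of walks that
--     holds on all walks shorter than the path transfers to a geodesic; in
--     module Colourings this makes rainbow colourings strongly rainbow when
--     rc ≤ 2, rvc ≤ 2 or trc ≤ 4, and yields the explicit small colourings.
--   * Diameter (module Diameter): walking out of a ball of radius 1 or 2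
--     produces a pair of vertices at distance exactly 2 or 3; with G complete
--     or of diameter ≤ 2 this pins down diam G.

open import Defs
open import Data.Nat using (ℕ; zero; suc; pred; _+_; _≤_; _≥_; _<_; z≤n; s≤s; s≤s⁻¹; _≤?_)
open import Data.Nat.Properties
  using (≤-refl; ≤-trans; ≤-antisym; ≤-reflexive; <⇒≤; ≰⇒>; <⇒≱; <⇒≢; >⇒≢; +-mono-≤; m≤n⇒m<n∨m≡n)
open import Data.Fin using (Fin; zero; suc; inject₁; fromℕ; _≟_)
open import Data.Fin.Properties using (any?; injective⇒≤; inject₁-injective; fromℕ≢inject₁)
open import Data.Bool using (true)
import Data.Bool as Bool
open import Data.List using (List; []; _∷_; _++_; length; lookup; map)
open import Data.List.Properties using (length-++; length-map)
open import Data.List.Membership.Propositional using (_∈_)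
open import Data.List.Membership.Propositional.Properties using (∈-lookup; ∈-map⁻)
import Data.List.Relation.Unary.All as All
open import Data.List.Relation.Unary.All using ([]; _∷_)
open import Data.List.Relation.Unary.AllPairs using ([]; _∷_)
open import Data.List.Relation.Unary.Unique.Propositional using (Unique)
open import Data.List.Relation.Unary.Unique.Propositional.Properties using (map⁺; ++⁺)
open import Data.Product using (Σ; _×_; _,_; proj₁; proj₂)
open import Data.Sum using (_⊎_; inj₁; inj₂)
open import Function using (_∘_)
open import Function.Bundles using (_⇔_; mk⇔; module Equivalence)
open import Function.Construct.Composition using (_⇔-∘_)
open import Function.Construct.Symmetry using (⇔-sym)
open import Relation.Binary.PropositionalEquality
  using (_≡_; _≢_; refl; sym; trans; cong; cong₂; subst; module ≡-Reasoning)
open import Relation.Nullary using (¬_; Dec; yes; no; contradiction; contraposition)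
open import Relation.Nullary.Decidable using (_×-dec_; _⊎-dec_; ¬?)

lookup-injective : ∀ {A : Set} {xs : List A} → Unique xs →
                   ∀ i j → lookup xs i ≡ lookup xs j → i ≡ j
lookup-injective (_    ∷ _) zero    zero    _  = refl
lookup-injective (x∉xs ∷ _) zero    (suc j) eq =
  contradiction eq (All.lookup x∉xs (∈-lookup j))
lookup-injective (x∉xs ∷ _) (suc i) zero    eq =
  contradiction (sym eq) (All.lookup x∉xs (∈-lookup i))
lookup-injective (_    ∷ u) (suc i) (suc j) eq = cong suc (lookup-injective u i j eq)

unique⇒length≤ : ∀ {k} {xs : List (Fin k)} → Unique xs → length xs ≤ k
unique⇒length≤ u = injective⇒≤ (lookup-injective u _ _)

-- A walk of length ℓ has ℓ edges and pred ℓ internal vertices; a total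
-- colouring needs ℓ + pred ℓ colours, and at most 2m of them allow ℓ ≤ m.
halve : ∀ ℓ m → ℓ + pred ℓ ≤ m + m → ℓ ≤ m
halve zero    m _ = z≤n
halve (suc l) m bound with suc l ≤? m
... | yes l<m = l<m
... | no  l≮m = contradiction (+-mono-≤ m≤l m≤l) (<⇒≱ bound)
  where
    m≤l : m ≤ l
    m≤l = s≤s⁻¹ (≰⇒> l≮m)

pred≤⇒≤suc : ∀ ℓ {k} → pred ℓ ≤ k → ℓ ≤ suc k
pred≤⇒≤suc zero    _ = z≤n
pred≤⇒≤suc (suc l) bound = s≤s bound

min≥1 : ∀ {P : ℕ → Set} {k} → IsMin P k → ¬ P 0 → 1 ≤ k
min≥1 {k = zero}  (P0 , _) ¬P0 = contradiction P0 ¬P0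
min≥1 {k = suc _} _        _   = s≤s z≤n

min≡1 : ∀ {P : ℕ → Set} {k} → IsMin P k → ¬ P 0 → P 1 → k ≡ 1
min≡1 isMin ¬P0 P1 = ≤-antisym (proj₂ isMin 1 P1) (min≥1 isMin ¬P0)

conventionZero : ∀ {C X : Set} {k} → C → (C × k ≡ 0) ⊎ (¬ C × X) → k ≡ 0
conventionZero _ (inj₁ (_ , k≡0)) = k≡0
conventionZero c (inj₂ (¬c , _))  = contradiction c ¬c

conventionMin : ∀ {C X : Set} {k} → ¬ C → (C × k ≡ 0) ⊎ (¬ C × X) → X
conventionMin ¬c (inj₁ (c , _)) = contradiction c ¬c
conventionMin _  (inj₂ (_ , x)) = x

thresholdIff : ∀ {x y m a} → x ≤ y → (x ≤ m → y ≡ x) → a ≤ m → x ≡ a ⇔ y ≡ a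
thresholdIff x≤y agree a≤m = mk⇔ (λ { refl → agree a≤m }) λ y≡a →
  trans (sym (agree (≤-trans x≤y (≤-trans (≤-reflexive y≡a) a≤m)))) y≡a

decidedIff : ∀ {P Q : Set} → Dec P → (P → Q) → (¬ P → ¬ Q) → P ⇔ Q
decidedIff (yes p) to _    = mk⇔ to (λ _ → p)
decidedIff (no ¬p) _  from = mk⇔ (λ p → contradiction p ¬p) (λ q → contradiction q (from ¬p))

twoVertices : ∀ {n} → 2 ≤ n → Σ (Fin n) λ x → Σ (Fin n) λ y → x ≢ y
twoVertices (s≤s (s≤s _)) = zero , suc zero , λ ()

module Walks {n : ℕ} (G : Graph n) where

  adj? : ∀ u v → Dec (Adj G u v)
  adj? u v = adj G u v Bool.≟ true

  adj⇒≢ : ∀ {u v} → Adj G u v → u ≢ v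
  adj⇒≢ {u} uv refl = contradiction (trans (sym uv) (irrefl G u)) λ ()

  completeOrMissingEdge : Complete G ⊎ Σ (Fin n) λ u → Σ (Fin n) λ v → u ≢ v × ¬ Adj G u v
  completeOrMissingEdge with any? (λ u → any? (λ v → ¬? (u ≟ v) ×-dec ¬? (adj? u v)))
  ... | yes missing = inj₂ missing
  ... | no  none    = inj₁ complete
    where
      complete : Complete G
      complete u v u≢v with adj? u v
      ... | yes uv = uv
      ... | no ¬uv = contradiction (u , v , u≢v , ¬uv) none

  complete? : Dec (Complete G)
  complete? with completeOrMissingEdge
  ... | inj₁ complete              = yes complete
  ... | inj₂ (u , v , u≢v , ¬uv) = no (λ complete → ¬uv (complete u v u≢v))

  vertCols≡map : ∀ {k} (f : Fin n → Fin k) xs → vertCols G f xs ≡ map f xs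
  vertCols≡map f []       = refl
  vertCols≡map f (x ∷ xs) = cong (f x ∷_) (vertCols≡map f xs)

  edgeCols-recolour : ∀ {k l} (g : Fin k → Fin l) (c : Fin n → Fin n → Fin k) {u v} (w : Walk G u v) →
                      edgeCols G (λ x y → g (c x y)) w ≡ map g (edgeCols G c w)
  edgeCols-recolour g c [ _ ]      = refl
  edgeCols-recolour g c (step _ w) = cong (_ ∷_) (edgeCols-recolour g c w)

  length-edgeCols : ∀ {k} (c : Fin n → Fin n → Fin k) {u v} (w : Walk G u v) →
                    length (edgeCols G c w) ≡ len G w
  length-edgeCols c [ _ ]      = refl
  length-edgeCols c (step _ w) = cong suc (length-edgeCols c w)

  length-initVerts : ∀ {u v} (w : Walk G u v) → length (initVerts G w) ≡ len G w
  length-initVerts [ _ ]      = refl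
  length-initVerts (step _ w) = cong suc (length-initVerts w)

  length-internalCols : ∀ {k} (f : Fin n → Fin k) {u v} (w : Walk G u v) →
                        length (vertCols G f (internal G w)) ≡ pred (len G w)
  length-internalCols f [ _ ]      = refl
  length-internalCols f (step _ w) = begin
    length (vertCols G f (initVerts G w)) ≡⟨ cong length (vertCols≡map f (initVerts G w)) ⟩
    length (map f (initVerts G w))        ≡⟨ length-map f (initVerts G w) ⟩
    length (initVerts G w)                ≡⟨ length-initVerts w ⟩
    len G w                               ∎
    where open ≡-Reasoning

  totalCols : ∀ {k} → (Fin n → Fin k) → (Fin n → Fin n → Fin k) → ∀ {u v} → Walk G u v → List (Fin k)
  totalCols f c w = edgeCols G c w ++ vertCols G f (internal G w)

  rainbow⇒len≤ : ∀ {k} (c : Fin n → Fin n → Fin k) {u v} (w : Walk G u v) →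
                 Unique (edgeCols G c w) → len G w ≤ k
  rainbow⇒len≤ c w rb = subst (_≤ _) (length-edgeCols c w) (unique⇒length≤ rb)

  vertexRainbow⇒len≤ : ∀ {k} (f : Fin n → Fin k) {u v} (w : Walk G u v) →
                       Unique (vertCols G f (internal G w)) → len G w ≤ suc k
  vertexRainbow⇒len≤ f w rb =
    pred≤⇒≤suc (len G w) (subst (_≤ _) (length-internalCols f w) (unique⇒length≤ rb))

  totalRainbow⇒len≤ : ∀ {k} (f : Fin n → Fin k) (c : Fin n → Fin n → Fin k) {u v} (w : Walk G u v) →
                      Unique (totalCols f c w) → len G w + pred (len G w) ≤ k
  totalRainbow⇒len≤ f c w rb = subst (_≤ _) length-totalCols (unique⇒length≤ rb)
    where
      length-totalCols : length (totalCols f c w) ≡ len G w + pred (len G w)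
      length-totalCols = trans (length-++ (edgeCols G c w))
                               (cong₂ _+_ (length-edgeCols c w) (length-internalCols f w))

  short⇒rainbow : ∀ {k} (c : Fin n → Fin n → Fin k) {u v} (w : Walk G u v) →
                  len G w ≤ 1 → Unique (edgeCols G c w)
  short⇒rainbow c [ _ ]               _        = []
  short⇒rainbow c (step _ [ _ ])      _        = [] ∷ []
  short⇒rainbow c (step _ (step _ _)) (s≤s ())

  short⇒vertexRainbow : ∀ {k} (f : Fin n → Fin k) {u v} (w : Walk G u v) →
                        len G w ≤ 2 → Unique (vertCols G f (internal G w))
  short⇒vertexRainbow f [ _ ]                        _              = []
  short⇒vertexRainbow f (step _ [ _ ])               _              = []
  short⇒vertexRainbow f (step _ (step _ [ _ ]))      _              = [] ∷ []
  short⇒vertexRainbow f (step _ (step _ (step _ _))) (s≤s (s≤s ()))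

  short⇒totalRainbow : ∀ {k} (f : Fin n → Fin k) (c : Fin n → Fin n → Fin k) {u v} (w : Walk G u v) →
                       len G w ≤ 1 → Unique (totalCols f c w)
  short⇒totalRainbow f c [ _ ]               _        = []
  short⇒totalRainbow f c (step _ [ _ ])      _        = [] ∷ []
  short⇒totalRainbow f c (step _ (step _ _)) (s≤s ())

  Within2 : Fin n → Fin n → Set
  Within2 u v = u ≡ v ⊎ Adj G u v ⊎ Σ (Fin n) λ w → Adj G u w × Adj G w v

  within2? : ∀ u v → Dec (Within2 u v)
  within2? u v = (u ≟ v) ⊎-dec adj? u v ⊎-dec any? (λ w → adj? u w ×-dec adj? w v)

  ShortWalks : ℕ → Set
  ShortWalks m = ∀ u v → Σ (Walk G u v) λ w → len G w ≤ m

  walk≤1⇒adj : ∀ {u v} → u ≢ v → (w : Walk G u v) → len G w ≤ 1 → Adj G u v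
  walk≤1⇒adj u≢v [ _ ]               _        = contradiction refl u≢v
  walk≤1⇒adj u≢v (step uv [ _ ])     _        = uv
  walk≤1⇒adj u≢v (step _ (step _ _)) (s≤s ())

  walk≤2⇒within2 : ∀ {u v} (w : Walk G u v) → len G w ≤ 2 → Within2 u v
  walk≤2⇒within2 [ _ ]                        _              = inj₁ refl
  walk≤2⇒within2 (step uv [ _ ])              _              = inj₂ (inj₁ uv)
  walk≤2⇒within2 (step uw (step wv [ _ ]))    _              = inj₂ (inj₂ (_ , uw , wv))
  walk≤2⇒within2 (step _ (step _ (step _ _))) (s≤s (s≤s ()))

  shortWalks⇒complete : ShortWalks 1 → Complete G
  shortWalks⇒complete short u v u≢v = walk≤1⇒adj u≢v (proj₁ (short u v)) (proj₂ (short u v))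

  shortWalks⇒within2 : ShortWalks 2 → ∀ u v → Within2 u v
  shortWalks⇒within2 short u v = walk≤2⇒within2 (proj₁ (short u v)) (proj₂ (short u v))

  ≢⇒len≥1 : ∀ {u v} → u ≢ v → (w : Walk G u v) → 1 ≤ len G w
  ≢⇒len≥1 u≢v [ _ ]      = contradiction refl u≢v
  ≢⇒len≥1 u≢v (step _ _) = s≤s z≤n

  trivialPath : ∀ u → Path G u u
  trivialPath u = [ u ] , [] ∷ []

  edgePath : ∀ {u v} → Adj G u v → Path G u v
  edgePath {v = v} uv = step uv [ v ] , (adj⇒≢ uv ∷ []) ∷ [] ∷ []

  twoEdgePath : ∀ {u w v} → u ≢ v → Adj G u w → Adj G w v → Path G u v
  twoEdgePath {v = v} u≢v uw wv =
    step uw (step wv [ v ]) , (adj⇒≢ uw ∷ u≢v ∷ []) ∷ (adj⇒≢ wv ∷ []) ∷ [] ∷ []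

  within2⇒path : ∀ {u v} → Within2 u v → Σ (Path G u v) λ p → len G (proj₁ p) ≤ 2
  within2⇒path {u} {v} near with u ≟ v | near
  ... | yes refl | _                         = trivialPath u , z≤n
  ... | no u≢v   | inj₁ u≡v                  = contradiction u≡v u≢v
  ... | no u≢v   | inj₂ (inj₁ uv)            = edgePath uv , s≤s z≤n
  ... | no u≢v   | inj₂ (inj₂ (_ , uw , wv)) = twoEdgePath u≢v uw wv , ≤-refl

  complete⇒shortPath : Complete G → ∀ u v → Σ (Path G u v) λ p → len G (proj₁ p) ≤ 1
  complete⇒shortPath complete u v with u ≟ v
  ... | yes refl = trivialPath u , z≤n
  ... | no u≢v   = edgePath (complete u v u≢v) , ≤-refl

  leavingEdge : (N : Fin n → Set) → (∀ x → Dec (N x)) → ∀ {x v} → Walk G x v → N x → ¬ N v →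
                Σ (Fin n) λ a → Σ (Fin n) λ b → N a × Adj G a b × ¬ N b
  leavingEdge N N? [ _ ]               Nx ¬Nv = contradiction Nx ¬Nv
  leavingEdge N N? (step {x} {y} xy w) Nx ¬Nv with N? y
  ... | yes Ny  = leavingEdge N N? w Ny ¬Nv
  ... | no  ¬Ny = x , y , Nx , xy , ¬Ny

  shortest⇒dist : ∀ {u v} (p : Path G u v) → (∀ (w : Walk G u v) → len G (proj₁ p) ≤ len G w) →
                  Dist G u v (len G (proj₁ p))
  shortest⇒dist p shortest = (p , refl) , λ j (q , len≡j) → subst (_ ≤_) len≡j (shortest (proj₁ q))

  within2⇒geodesic : ∀ {u v} → Within2 u v → Geodesic G u v
  within2⇒geodesic {u} {v} near with u ≟ v | adj? u v
  ... | yes refl | _       = trivialPath u , shortest⇒dist (trivialPath u) (λ _ → z≤n)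
  ... | no u≢v   | yes uv  = edgePath uv , shortest⇒dist (edgePath uv) (≢⇒len≥1 u≢v)
  ... | no u≢v   | no ¬uv with near
  ...   | inj₁ u≡v                 = contradiction u≡v u≢v
  ...   | inj₂ (inj₁ uv)           = contradiction uv ¬uv
  ...   | inj₂ (inj₂ (_ , uw , wv)) = p , shortest⇒dist p at-least-2
    where
      p : Path G u v
      p = twoEdgePath u≢v uw wv
      at-least-2 : ∀ (w : Walk G u v) → 2 ≤ len G w
      at-least-2 w = ≰⇒> (contraposition (walk≤1⇒adj u≢v w) ¬uv)

  -- Shortening to a geodesic: let Q be a property of walks holding on all
  -- walks shorter than m ≤ 3.  A path of length ≤ m with Q is a geodesic or
  -- is strictly longer than some geodesic; either way a geodesic with Q exists.
  shortenToGeodesic : (Q : ∀ {u v} → Walk G u v → Set) {m : ℕ} → m ≤ 3 →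
                      (∀ {u v} (w : Walk G u v) → len G w < m → Q w) →
                      ∀ {u v} (p : Path G u v) → len G (proj₁ p) ≤ m → Q (proj₁ p) →
                      Σ (Geodesic G u v) (λ g → Q (proj₁ (proj₁ g)))
  shortenToGeodesic Q m≤3 Q-short {u} {v} p p≤m Qp with within2? u v
  ... | no ¬near = (p , shortest⇒dist p at-least-3) , Qp
    where
      at-least-3 : ∀ (w : Walk G u v) → len G (proj₁ p) ≤ len G w
      at-least-3 w = ≤-trans (≤-trans p≤m m≤3) (≰⇒> (contraposition (walk≤2⇒within2 w) ¬near))
  ... | yes near with within2⇒geodesic near
  ...   | g with m≤n⇒m<n∨m≡n (proj₂ (proj₂ g) _ (p , refl))
  ...     | inj₁ g<p = g , Q-short (proj₁ (proj₁ g)) (≤-trans g<p p≤m)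
  ...     | inj₂ g≡p = (p , subst (Dist G u v) g≡p (proj₂ g)) , Qp

module Colourings {n : ℕ} (G : Graph n) where
  open Walks G

  HasRC HasSRC HasVRC HasSVRC HasTRC HasSTRC : ℕ → Set
  HasRC   k = Σ (EdgeColouring G k) (RainbowConnecting G)
  HasSRC  k = Σ (EdgeColouring G k) (StronglyRainbowConnecting G)
  HasVRC  k = Σ (Fin n → Fin k) (VertexRainbowConnecting G)
  HasSVRC k = Σ (Fin n → Fin k) (StronglyVertexRainbowConnecting G)
  HasTRC  k = Σ (TotalColouring G k) (TotalRainbowConnecting G)
  HasSTRC k = Σ (TotalColouring G k) (StronglyTotalRainbowConnecting G)

  src⇒rc : ∀ {k} → HasSRC k → HasRC k
  src⇒rc (c , connecting) = c , λ u v → proj₁ (proj₁ (connecting u v)) , proj₂ (connecting u v)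

  svrc⇒vrc : ∀ {k} → HasSVRC k → HasVRC k
  svrc⇒vrc (f , connecting) = f , λ u v → proj₁ (proj₁ (connecting u v)) , proj₂ (connecting u v)

  strc⇒trc : ∀ {k} → HasSTRC k → HasTRC k
  strc⇒trc (fc , connecting) = fc , λ u v → proj₁ (proj₁ (connecting u v)) , proj₂ (connecting u v)

  no-rc₀ : Fin n → ¬ HasRC 0
  no-rc₀ x ((c , _) , _) with c x x
  ... | ()

  no-vrc₀ : Fin n → ¬ HasVRC 0
  no-vrc₀ x (f , _) with f x
  ... | ()

  no-trc₀ : Fin n → ¬ HasTRC 0
  no-trc₀ x ((f , _) , _) with f x
  ... | ()

  rc⇒shortWalks : ∀ {k m} → HasRC k → k ≤ m → ShortWalks m
  rc⇒shortWalks ((c , _) , connecting) k≤m u v with connecting u v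
  ... | (p , _) , rb = p , ≤-trans (rainbow⇒len≤ c p rb) k≤m

  vrc⇒shortWalks : ∀ {k m} → HasVRC k → suc k ≤ m → ShortWalks m
  vrc⇒shortWalks (f , connecting) k<m u v with connecting u v
  ... | (p , _) , rb = p , ≤-trans (vertexRainbow⇒len≤ f p rb) k<m

  trc⇒shortWalks : ∀ {k m} → HasTRC k → k ≤ m + m → ShortWalks m
  trc⇒shortWalks ((f , c , _) , connecting) k≤2m u v with connecting u v
  ... | (p , _) , rb = p , halve (len G p) _ (≤-trans (totalRainbow⇒len≤ f c p rb) k≤2m)

  -- Below the thresholds rc ≤ 2, rvc ≤ 2, trc ≤ 4 connecting paths are short
  -- enough for shortenToGeodesic, so the same colouring is strongly connecting.
  rc⇒src : ∀ {k} → HasRC k → k ≤ 2 → HasSRC k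
  rc⇒src ((c , c-sym) , connecting) k≤2 = (c , c-sym) , λ u v →
    let (p , rb) = connecting u v in
    shortenToGeodesic (λ w → Unique (edgeCols G c w)) {2} (s≤s (s≤s z≤n))
      (λ w w<2 → short⇒rainbow c w (s≤s⁻¹ w<2)) p (≤-trans (rainbow⇒len≤ c (proj₁ p) rb) k≤2) rb

  vertexRainbowGeodesic : ∀ {k} (f : Fin n → Fin k) {u v} (p : Path G u v) → len G (proj₁ p) ≤ 3 →
                          Unique (vertCols G f (internal G (proj₁ p))) →
                          Σ (Geodesic G u v) λ g → Unique (vertCols G f (internal G (proj₁ (proj₁ g))))
  vertexRainbowGeodesic f = shortenToGeodesic (λ w → Unique (vertCols G f (internal G w))) ≤-refl
                              (λ w w<3 → short⇒vertexRainbow f w (s≤s⁻¹ w<3))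

  vrc⇒svrc : ∀ {k} → HasVRC k → k ≤ 2 → HasSVRC k
  vrc⇒svrc (f , connecting) k≤2 = f , λ u v →
    let (p , rb) = connecting u v in
    vertexRainbowGeodesic f p (≤-trans (vertexRainbow⇒len≤ f (proj₁ p) rb) (s≤s k≤2)) rb

  trc⇒strc : ∀ {k} → HasTRC k → k ≤ 4 → HasSTRC k
  trc⇒strc ((f , c , c-sym) , connecting) k≤4 = (f , c , c-sym) , λ u v →
    let (p , rb) = connecting u v in
    shortenToGeodesic (λ w → Unique (totalCols f c w)) {2} (s≤s (s≤s z≤n))
      (λ w w<2 → short⇒totalRainbow f c w (s≤s⁻¹ w<2)) p
      (halve (len G (proj₁ p)) 2 (≤-trans (totalRainbow⇒len≤ f c (proj₁ p) rb) k≤4)) rb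

  -- In a graph of diameter ≤ 2 every geodesic has at most one internal
  -- vertex, so a single vertex colour suffices.
  within2⇒svrc₁ : (∀ u v → Within2 u v) → HasSVRC 1
  within2⇒svrc₁ near = one , λ u v →
    let (p , p≤2) = within2⇒path (near u v) in
    vertexRainbowGeodesic one p (≤-trans p≤2 (s≤s (s≤s z≤n))) (short⇒vertexRainbow one (proj₁ p) p≤2)
    where
      one : Fin n → Fin 1
      one _ = zero

  complete⇒shortGeodesic : Complete G → ∀ u v → Σ (Geodesic G u v) λ g → len G (proj₁ (proj₁ g)) ≤ 1
  complete⇒shortGeodesic complete u v =
    let (p , p≤1) = complete⇒shortPath complete u v in
    shortenToGeodesic (λ w → len G w ≤ 1) {1} (s≤s z≤n) (λ _ → <⇒≤) p p≤1 p≤1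

  complete⇒src₁ : Complete G → HasSRC 1
  complete⇒src₁ complete = ((λ _ _ → zero) , λ _ _ → refl) , λ u v →
    let (g , g≤1) = complete⇒shortGeodesic complete u v in
    g , short⇒rainbow _ (proj₁ (proj₁ g)) g≤1

  complete⇒strc₁ : Complete G → HasSTRC 1
  complete⇒strc₁ complete = ((λ _ → zero) , (λ _ _ → zero) , λ _ _ → refl) , λ u v →
    let (g , g≤1) = complete⇒shortGeodesic complete u v in
    g , short⇒totalRainbow _ _ (proj₁ (proj₁ g)) g≤1

  -- A strongly rainbow edge-colouring with k ≤ 2 colours has geodesics of
  -- length ≤ 2; giving every vertex one new colour makes it strongly total-rainbow.
  src⇒strc-freshColour : ∀ {k} → HasSRC k → k ≤ 2 → HasSTRC (suc k)
  src⇒strc-freshColour {k} ((c , c-sym) , connecting) k≤2 =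
    (new , old , λ u v → cong inject₁ (c-sym u v)) , λ u v →
    let (g , rb) = connecting u v in g , totalRainbow (proj₁ (proj₁ g)) rb
    where
      new : Fin n → Fin (suc k)
      new _ = fromℕ k
      old : Fin n → Fin n → Fin (suc k)
      old x y = inject₁ (c x y)
      totalRainbow : ∀ {u v} (w : Walk G u v) → Unique (edgeCols G c w) → Unique (totalCols new old w)
      totalRainbow w rb = ++⁺ edgesDistinct verticesDistinct disjoint
        where
          edgesDistinct : Unique (edgeCols G old w)
          edgesDistinct = subst Unique (sym (edgeCols-recolour inject₁ c w)) (map⁺ inject₁-injective rb)
          verticesDistinct : Unique (vertCols G new (internal G w))
          verticesDistinct = short⇒vertexRainbow new w (≤-trans (rainbow⇒len≤ c w rb) k≤2)
          disjoint : ∀ {x} → ¬ (x ∈ edgeCols G old w × x ∈ vertCols G new (internal G w))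
          disjoint {x} (x∈edges , x∈vertices)
            with ∈-map⁻ inject₁ (subst (x ∈_) (edgeCols-recolour inject₁ c w) x∈edges)
               | ∈-map⁻ new (subst (x ∈_) (vertCols≡map new (internal G w)) x∈vertices)
          ... | _ , _ , x≡old | _ , _ , x≡new = fromℕ≢inject₁ (trans (sym x≡new) x≡old)

module Diameter {n : ℕ} (G : Graph n) where
  open Walks G
  open Colourings G using (complete⇒shortGeodesic)

  -- Leaving the closed neighbourhood of u yields a pair at distance exactly 2.
  pairAtDistance2 : Connected G → ∀ {u v} → u ≢ v → ¬ Adj G u v →
                    Σ (Fin n) λ a → Σ (Fin n) λ b → Dist G a b 2
  pairAtDistance2 connected {u} {v} u≢v ¬uv
    with leavingEdge (λ x → x ≡ u ⊎ Adj G u x) (λ x → (x ≟ u) ⊎-dec adj? u x)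
                     (proj₁ (connected u v)) (inj₁ refl) v-outside
    where
      v-outside : ¬ (v ≡ u ⊎ Adj G u v)
      v-outside (inj₁ v≡u) = u≢v (sym v≡u)
      v-outside (inj₂ uv)  = ¬uv uv
  ... | _ , _ , inj₁ refl , ub , b-out = contradiction (inj₂ ub) b-out
  ... | _ , b , inj₂ ua , ab , b-out =
    u , b , shortest⇒dist (twoEdgePath u≢b ua ab) at-least-2
    where
      u≢b : u ≢ b
      u≢b u≡b = b-out (inj₁ (sym u≡b))
      at-least-2 : ∀ (w : Walk G u b) → 2 ≤ len G w
      at-least-2 w = ≰⇒> (contraposition (walk≤1⇒adj u≢b w) (b-out ∘ inj₂))

  -- Leaving the ball of radius 2 around u yields a pair at distance exactly 3.
  pairAtDistance3 : Connected G → ∀ {u v} → ¬ Within2 u v →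
                    Σ (Fin n) λ a → Σ (Fin n) λ b → Dist G a b 3
  pairAtDistance3 connected {u} {v} ¬near
    with leavingEdge (Within2 u) (within2? u) (proj₁ (connected u v)) (inj₁ refl) ¬near
  ... | _ , _ , inj₁ refl , ub , b-far                 = contradiction (inj₂ (inj₁ ub)) b-far
  ... | a , _ , inj₂ (inj₁ ua) , ab , b-far            = contradiction (inj₂ (inj₂ (a , ua , ab))) b-far
  ... | a , b , inj₂ (inj₂ (c , uc , ca)) , ab , b-far = u , b , shortest⇒dist p at-least-3
    where
      u≢a : u ≢ a
      u≢a refl = b-far (inj₂ (inj₁ ab))
      u≢b : u ≢ b
      u≢b u≡b = b-far (inj₁ u≡b)
      c≢b : c ≢ b
      c≢b refl = b-far (inj₂ (inj₁ uc))
      p : Path G u b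
      p = step uc (step ca (step ab [ b ])) ,
          (adj⇒≢ uc ∷ u≢a ∷ u≢b ∷ []) ∷ (adj⇒≢ ca ∷ c≢b ∷ []) ∷ (adj⇒≢ ab ∷ []) ∷ [] ∷ []
      at-least-3 : ∀ (w : Walk G u b) → 3 ≤ len G w
      at-least-3 w = ≰⇒> (contraposition (walk≤2⇒within2 w) b-far)

  diam≤ : ∀ {D m} → Diam G D → (∀ u v → Σ (Path G u v) λ p → len G (proj₁ p) ≤ m) → D ≤ m
  diam≤ ((a , b , D-dist) , _) short =
    ≤-trans (proj₂ D-dist _ (proj₁ (short a b) , refl)) (proj₂ (short a b))

  dist≤diam : ∀ {D u v d} → Diam G D → Dist G u v d → d ≤ D
  dist≤diam (_ , bounds) = bounds _ _ _

  complete⇒diam≡1 : ∀ {D x y} → x ≢ y → Complete G → Diam G D → D ≡ 1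
  complete⇒diam≡1 {x = x} {y} x≢y complete isDiam =
    ≤-antisym (diam≤ isDiam (complete⇒shortPath complete))
              (≤-trans (≢⇒len≥1 x≢y xy) (dist≤diam isDiam xy-dist))
    where
      xy-geodesic : Geodesic G x y
      xy-geodesic = proj₁ (complete⇒shortGeodesic complete x y)
      xy : Walk G x y
      xy = proj₁ (proj₁ xy-geodesic)
      xy-dist : Dist G x y (len G xy)
      xy-dist = proj₂ xy-geodesic

  incomplete⇒diam≥2 : ∀ {D} → Connected G → ¬ Complete G → Diam G D → 2 ≤ D
  incomplete⇒diam≥2 connected incomplete isDiam with completeOrMissingEdge
  ... | inj₁ complete              = contradiction complete incomplete
  ... | inj₂ (_ , _ , u≢v , ¬uv) =
    let (_ , _ , dist₂) = pairAtDistance2 connected u≢v ¬uv in dist≤diam isDiam dist₂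

  diam≤2⇔within2 : ∀ {D} → Connected G → Diam G D → D ≤ 2 ⇔ (∀ u v → Within2 u v)
  diam≤2⇔within2 {D} connected isDiam =
    mk⇔ within2 (λ near → diam≤ isDiam (λ u v → within2⇒path (near u v)))
    where
      within2 : D ≤ 2 → ∀ u v → Within2 u v
      within2 D≤2 u v with within2? u v
      ... | yes near = near
      ... | no ¬near = let (_ , _ , dist₃) = pairAtDistance3 connected ¬near in
                       contradiction (≤-trans (dist≤diam isDiam dist₃) D≤2) λ { (s≤s (s≤s ())) }

module Invariants {n : ℕ} (two : 2 ≤ n) (G : Graph n) (connected : Connected G)
  {diam rc src rvc srvc trc strc : ℕ}
  (isDiam : Diam G diam) (isRC : RC G rc) (isSRC : SRC G src) (isRVC : RVC G rvc)
  (isSRVC : SRVC G srvc) (isTRC : TRC G trc) (isSTRC : STRC G strc) where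

  open Walks G
  open Colourings G
  open Diameter G

  x₀ : Fin n
  x₀ = proj₁ (twoVertices two)

  rvcIsMin : ¬ Complete G → IsMin HasVRC rvc
  rvcIsMin incomplete = conventionMin incomplete isRVC

  srvcIsMin : ¬ Complete G → IsMin HasSVRC srvc
  srvcIsMin incomplete = conventionMin incomplete isSRVC

  rc≤src : rc ≤ src
  rc≤src = proj₂ isRC src (src⇒rc (proj₁ isSRC))

  trc≤strc : trc ≤ strc
  trc≤strc = proj₂ isTRC strc (strc⇒trc (proj₁ isSTRC))

  rvc≤srvc : rvc ≤ srvc
  rvc≤srvc with complete?
  ... | yes complete  =
    ≤-reflexive (trans (conventionZero complete isRVC) (sym (conventionZero complete isSRVC)))
  ... | no incomplete = proj₂ (rvcIsMin incomplete) srvc (svrc⇒vrc (proj₁ (srvcIsMin incomplete)))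

  diam≡1 : Complete G → diam ≡ 1
  diam≡1 complete = complete⇒diam≡1 (proj₂ (proj₂ (twoVertices two))) complete isDiam

  rc≡1 : Complete G → rc ≡ 1
  rc≡1 complete = min≡1 isRC (no-rc₀ x₀) (src⇒rc (complete⇒src₁ complete))

  src≡1 : Complete G → src ≡ 1
  src≡1 complete = min≡1 isSRC (no-rc₀ x₀ ∘ src⇒rc) (complete⇒src₁ complete)

  trc≡1 : Complete G → trc ≡ 1
  trc≡1 complete = min≡1 isTRC (no-trc₀ x₀) (strc⇒trc (complete⇒strc₁ complete))

  strc≡1 : Complete G → strc ≡ 1
  strc≡1 complete = min≡1 isSTRC (no-trc₀ x₀ ∘ strc⇒trc) (complete⇒strc₁ complete)

  diam≥2 : ¬ Complete G → 2 ≤ diam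
  diam≥2 incomplete = incomplete⇒diam≥2 connected incomplete isDiam

  rc≥2 : ¬ Complete G → 2 ≤ rc
  rc≥2 incomplete =
    ≰⇒> (contraposition (shortWalks⇒complete ∘ rc⇒shortWalks (proj₁ isRC)) incomplete)

  rvc≥1 : ¬ Complete G → 1 ≤ rvc
  rvc≥1 incomplete = min≥1 (rvcIsMin incomplete) (no-vrc₀ x₀)

  trc≥3 : ¬ Complete G → 3 ≤ trc
  trc≥3 incomplete =
    ≰⇒> (contraposition (shortWalks⇒complete ∘ trc⇒shortWalks (proj₁ isTRC)) incomplete)

  incompleteIf : ∀ {x a b : ℕ} → (Complete G → x ≡ a) → x ≡ b → a ≢ b → ¬ Complete G
  incompleteIf value x≡b a≢b complete = a≢b (trans (sym (value complete)) x≡b)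

  src≡rc : rc ≤ 2 → src ≡ rc
  src≡rc rc≤2 = ≤-antisym (proj₂ isSRC rc (rc⇒src (proj₁ isRC) rc≤2)) rc≤src

  strc≡trc : trc ≤ 4 → strc ≡ trc
  strc≡trc trc≤4 = ≤-antisym (proj₂ isSTRC trc (trc⇒strc (proj₁ isTRC) trc≤4)) trc≤strc

  srvc≡rvc : rvc ≤ 2 → srvc ≡ rvc
  srvc≡rvc rvc≤2 with complete?
  ... | yes complete  = trans (conventionZero complete isSRVC) (sym (conventionZero complete isRVC))
  ... | no incomplete = ≤-antisym
    (proj₂ (srvcIsMin incomplete) rvc (vrc⇒svrc (proj₁ (rvcIsMin incomplete)) rvc≤2)) rvc≤srvc

  DiameterTwo : Set
  DiameterTwo = ¬ Complete G × (∀ u v → Within2 u v)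

  diam≡2⇔diameterTwo : diam ≡ 2 ⇔ DiameterTwo
  diam≡2⇔diameterTwo = mk⇔
    (λ diam≡2 → incompleteIf diam≡1 diam≡2 (λ ()) ,
                Equivalence.to (diam≤2⇔within2 connected isDiam) (≤-reflexive diam≡2))
    (λ (incomplete , near) → ≤-antisym (Equivalence.from (diam≤2⇔within2 connected isDiam) near)
                                       (diam≥2 incomplete))

  srvc≡1⇔diameterTwo : srvc ≡ 1 ⇔ DiameterTwo
  srvc≡1⇔diameterTwo = mk⇔
    (λ srvc≡1 → let incomplete = incompleteIf (λ c → conventionZero c isSRVC) srvc≡1 (λ ()) in
      incomplete , shortWalks⇒within2
        (vrc⇒shortWalks (svrc⇒vrc (subst HasSVRC srvc≡1 (proj₁ (srvcIsMin incomplete)))) ≤-refl))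
    (λ (incomplete , near) → ≤-antisym (proj₂ (srvcIsMin incomplete) 1 (within2⇒svrc₁ near))
                                       (≤-trans (rvc≥1 incomplete) rvc≤srvc))

  characterise : ∀ {x a : ℕ} → (Complete G → x ≡ a) → (¬ Complete G → x ≢ a) → Complete G ⇔ x ≡ a
  characterise = decidedIff complete?

  completeCharacterisations :
    (Complete G ⇔ diam ≡ 1) × (Complete G ⇔ rc ≡ 1) × (Complete G ⇔ src ≡ 1)
    × (Complete G ⇔ rvc ≡ 0) × (Complete G ⇔ srvc ≡ 0)
    × (Complete G ⇔ trc ≡ 1) × (Complete G ⇔ strc ≡ 1)
  completeCharacterisations =
      characterise diam≡1 (>⇒≢ ∘ diam≥2)
    , characterise rc≡1 (>⇒≢ ∘ rc≥2)
    , characterise src≡1 (λ incomplete → >⇒≢ (≤-trans (rc≥2 incomplete) rc≤src))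
    , characterise (λ c → conventionZero c isRVC) (>⇒≢ ∘ rvc≥1)
    , characterise (λ c → conventionZero c isSRVC) (λ incomplete → >⇒≢ (≤-trans (rvc≥1 incomplete) rvc≤srvc))
    , characterise trc≡1 (λ incomplete → >⇒≢ (≤-trans 2≤3 (trc≥3 incomplete)))
    , characterise strc≡1 (λ incomplete → >⇒≢ (≤-trans 2≤3 (≤-trans (trc≥3 incomplete) trc≤strc)))
    where
      2≤3 : 2 ≤ 3
      2≤3 = s≤s (s≤s z≤n)

  incompleteCharacterisation : (strc ≥ trc × trc ≥ 3) ⇔ (¬ Complete G)
  incompleteCharacterisation = mk⇔
    (λ (_ , 3≤trc) → incompleteIf trc≡1 refl (<⇒≢ (≤-trans (s≤s (s≤s z≤n)) 3≤trc)))
    (λ incomplete → trc≤strc , trc≥3 incomplete)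

  rc≡2⇔src≡2 : rc ≡ 2 ⇔ src ≡ 2
  rc≡2⇔src≡2 = thresholdIff rc≤src src≡rc ≤-refl

  rvc≡1⇔srvc≡1 : rvc ≡ 1 ⇔ srvc ≡ 1
  rvc≡1⇔srvc≡1 = thresholdIff rvc≤srvc srvc≡rvc (s≤s z≤n)

  rvc≡2⇔srvc≡2 : rvc ≡ 2 ⇔ srvc ≡ 2
  rvc≡2⇔srvc≡2 = thresholdIff rvc≤srvc srvc≡rvc ≤-refl

  trc≡3⇔strc≡3 : trc ≡ 3 ⇔ strc ≡ 3
  trc≡3⇔strc≡3 = thresholdIff trc≤strc strc≡trc (s≤s (s≤s (s≤s z≤n)))

  trc≡4⇔strc≡4 : trc ≡ 4 ⇔ strc ≡ 4
  trc≡4⇔strc≡4 = thresholdIff trc≤strc strc≡trc ≤-refl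

  srvc≡1⇔diam≡2 : srvc ≡ 1 ⇔ diam ≡ 2
  srvc≡1⇔diam≡2 = ⇔-sym diam≡2⇔diameterTwo ⇔-∘ srvc≡1⇔diameterTwo

  -- rc = 2 implies trc = strc = 3: a fresh vertex colour gives strc ≤ 3.
  rc≡2⇒trc≡strc≡3 : rc ≡ 2 ⊎ src ≡ 2 → trc ≡ 3 × strc ≡ 3
  rc≡2⇒trc≡strc≡3 (inj₁ rc≡2)  = rc≡2⇒trc≡strc≡3 (inj₂ (Equivalence.to rc≡2⇔src≡2 rc≡2))
  rc≡2⇒trc≡strc≡3 (inj₂ src≡2) = trc≡3 , Equivalence.to trc≡3⇔strc≡3 trc≡3
    where
      strc≤3 : strc ≤ 3
      strc≤3 = proj₂ isSTRC 3 (src⇒strc-freshColour (subst HasSRC src≡2 (proj₁ isSRC)) ≤-refl)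
      trc≡3 : trc ≡ 3
      trc≡3 = ≤-antisym (≤-trans trc≤strc strc≤3) (trc≥3 (incompleteIf src≡1 src≡2 (λ ())))

  rc≡2⇒diameterTwo : rc ≡ 2 → DiameterTwo
  rc≡2⇒diameterTwo rc≡2 = incompleteIf rc≡1 rc≡2 (λ ()) ,
    shortWalks⇒within2 (rc⇒shortWalks (proj₁ isRC) (≤-reflexive rc≡2))

  trc≡⇒diameterTwo : ∀ {a} → 1 < a → a ≤ 4 → trc ≡ a → DiameterTwo
  trc≡⇒diameterTwo 1<a a≤4 trc≡a = incompleteIf trc≡1 trc≡a (<⇒≢ 1<a) ,
    shortWalks⇒within2 (trc⇒shortWalks (proj₁ isTRC) (≤-trans (≤-reflexive trc≡a) a≤4))

  smallConnection⇒diameterTwo :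
    rc ≡ 2 ⊎ src ≡ 2 ⊎ trc ≡ 3 ⊎ strc ≡ 3 ⊎ trc ≡ 4 ⊎ strc ≡ 4 → DiameterTwo
  smallConnection⇒diameterTwo (inj₁ rc≡2) = rc≡2⇒diameterTwo rc≡2
  smallConnection⇒diameterTwo (inj₂ (inj₁ src≡2)) =
    rc≡2⇒diameterTwo (Equivalence.from rc≡2⇔src≡2 src≡2)
  smallConnection⇒diameterTwo (inj₂ (inj₂ (inj₁ trc≡3))) =
    trc≡⇒diameterTwo (s≤s (s≤s z≤n)) (s≤s (s≤s (s≤s z≤n))) trc≡3
  smallConnection⇒diameterTwo (inj₂ (inj₂ (inj₂ (inj₁ strc≡3)))) =
    trc≡⇒diameterTwo (s≤s (s≤s z≤n)) (s≤s (s≤s (s≤s z≤n))) (Equivalence.from trc≡3⇔strc≡3 strc≡3)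
  smallConnection⇒diameterTwo (inj₂ (inj₂ (inj₂ (inj₂ (inj₁ trc≡4))))) =
    trc≡⇒diameterTwo (s≤s (s≤s z≤n)) ≤-refl trc≡4
  smallConnection⇒diameterTwo (inj₂ (inj₂ (inj₂ (inj₂ (inj₂ strc≡4))))) =
    trc≡⇒diameterTwo (s≤s (s≤s z≤n)) ≤-refl (Equivalence.from trc≡4⇔strc≡4 strc≡4)

  diameterTwo⇒values : DiameterTwo → rvc ≡ 1 × srvc ≡ 1 × diam ≡ 2
  diameterTwo⇒values d2 =
    Equivalence.from rvc≡1⇔srvc≡1 srvc≡1 , srvc≡1 , Equivalence.from diam≡2⇔diameterTwo d2
    where
      srvc≡1 : srvc ≡ 1
      srvc≡1 = Equivalence.from srvc≡1⇔diameterTwo d2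

theorem2p3 : (n : ℕ) → 2 ≤ n → (G : Graph n) → Connected G →
    (diam rc src rvc srvc trc strc : ℕ) →
    Diam G diam → RC G rc → SRC G src → RVC G rvc → SRVC G srvc →
    TRC G trc → STRC G strc →
    -- (a)
    ((Complete G ⇔ diam ≡ 1) × (Complete G ⇔ rc ≡ 1) × (Complete G ⇔ src ≡ 1)
      × (Complete G ⇔ rvc ≡ 0) × (Complete G ⇔ srvc ≡ 0)
      × (Complete G ⇔ trc ≡ 1) × (Complete G ⇔ strc ≡ 1))
    -- (b)
    × ((strc ≥ trc × trc ≥ 3) ⇔ (¬ Complete G))
    -- (c)
    × (rc ≡ 2 ⇔ src ≡ 2)
    × ((rvc ≡ 1 ⇔ srvc ≡ 1) × (srvc ≡ 1 ⇔ diam ≡ 2))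
    × (rvc ≡ 2 ⇔ srvc ≡ 2)
    × (trc ≡ 3 ⇔ strc ≡ 3)
    × (trc ≡ 4 ⇔ strc ≡ 4)
    × ((rc ≡ 2 ⊎ src ≡ 2) → (trc ≡ 3 × strc ≡ 3))
    × ((rc ≡ 2 ⊎ src ≡ 2 ⊎ trc ≡ 3 ⊎ strc ≡ 3 ⊎ trc ≡ 4 ⊎ strc ≡ 4)
        → (rvc ≡ 1 × srvc ≡ 1 × diam ≡ 2))
theorem2p3 n two G connected diam rc src rvc srvc trc strc
           isDiam isRC isSRC isRVC isSRVC isTRC isSTRC =
    completeCharacterisations
  , incompleteCharacterisation
  , rc≡2⇔src≡2
  , (rvc≡1⇔srvc≡1 , srvc≡1⇔diam≡2)
  , rvc≡2⇔srvc≡2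
  , trc≡3⇔strc≡3
  , trc≡4⇔strc≡4
  , rc≡2⇒trc≡strc≡3
  , diameterTwo⇒values ∘ smallConnection⇒diameterTwo
  where open Invariants two G connected isDiam isRC isSRC isRVC isSRVC isTRC isSTRC
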